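{- (a) For every $n\ge 1$, $\bar{\gamma}_R(P_n)=\lceil \tfrac{2}{3}n\rceil$, and for every $n\ge 3$, $\bar{\gamma}_R(C_n)=\lfloor \tfrac{2}{3}n\rfloor$. (b) For every $n\ge 2$ and positive integers $m_1\le m_2\le\dots\le m_n$, $\bar{\gamma}_R(K_{m_1,\dots,m_n})=2$.
   Context: $P_n$ is the path on $n$ vertices, $C_n$ the cycle on $n$ vertices, and $K_{m_1,\dots,m_n}$ the complete $n$-partite graph with parts of sizes $m_1,\dots,m_n$. For a graph $G$ and vertex $v$, $N[v]$ is the closed neighbourhood of $v$. A two neighbour packing of $G$ is a set $A\subseteq V(G)$ with $|N[v]\cap A|\le 2$ for all $v\in V(G)$; $\bar{\gamma}_R(G)$ is the maximum size of a two neighbour packing of $G$. -}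

module Defs where

open import Data.Nat using (ℕ; zero; suc; _+_; _≤_; _∸_; _≡ᵇ_)
open import Data.Bool using (Bool; true; false; _∨_; _∧_; not)
open import Data.Fin using (Fin; toℕ; splitAt)
import Data.Fin as F
open import Data.Fin.Subset using (Subset; ∣_∣; _∩_)
open import Data.Vec using (Vec; []; _∷_; tabulate; sum)
open import Data.Sum using (inj₁; inj₂)
open import Data.Product using (Σ; _×_)
open import Relation.Binary.PropositionalEquality using (_≡_)

Graph : ℕ → Set
Graph N = Fin N → Fin N → Bool

closedNbhd : ∀ {N} → Graph N → Fin N → Subset N
closedNbhd G v = tabulate (λ u → (toℕ u ≡ᵇ toℕ v) ∨ G v u)

IsTwoNeighbourPacking : ∀ {N} → Graph N → Subset N → Set
IsTwoNeighbourPacking G A = ∀ v → ∣ closedNbhd G v ∩ A ∣ ≤ 2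

TwoPackingNumberIs : ∀ {N} → Graph N → ℕ → Set
TwoPackingNumberIs {N} G k =
  Σ (Subset N) (λ A → IsTwoNeighbourPacking G A × ∣ A ∣ ≡ k)
  × (∀ (A : Subset N) → IsTwoNeighbourPacking G A → ∣ A ∣ ≤ k)

adjNat : ℕ → ℕ → Bool
adjNat a b = ((a + 1) ≡ᵇ b) ∨ ((b + 1) ≡ᵇ a)

pathGraph : (n : ℕ) → Graph n
pathGraph n i j = adjNat (toℕ i) (toℕ j)

cycleGraph : (n : ℕ) → Graph n
cycleGraph n i j = adjNat (toℕ i) (toℕ j)
  ∨ ((toℕ i ≡ᵇ 0) ∧ (toℕ j ≡ᵇ (n ∸ 1)))
  ∨ ((toℕ j ≡ᵇ 0) ∧ (toℕ i ≡ᵇ (n ∸ 1)))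

-- Part index of a vertex: vertices of K_{m_1,…,m_n} are numbered consecutively,
-- the first m_1 in part 0, the next m_2 in part 1, etc.
part : ∀ {n} (ms : Vec ℕ n) → Fin (sum ms) → Fin n
part (m ∷ ms) v with splitAt m v
... | inj₁ _ = F.zero
... | inj₂ w = F.suc (part ms w)

completeMultipartite : ∀ {n} (ms : Vec ℕ n) → Graph (sum ms)
completeMultipartite ms u v = not (toℕ (part ms u) ≡ᵇ toℕ (part ms v))

-- In P_n and C_n the closed neighbourhood of an inner vertex t is the window
-- {t-1, t, t+1}, so a two neighbour packing A meets each window in at most two
-- vertices.  Summing over the n windows of the cycle counts every vertex three times,
-- hence 3|A| ≤ 2n on C_n; on P_n the two windows through the missing edge {n-1, 0}
-- are not neighbourhoods and contribute at most 3 each, hence 3|A| ≤ 2n + 2.  The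
-- vertices x ≢ 2 (mod 3) meet every window in exactly two vertices; they attain the
-- bound on P_n, and on C_n once the last vertex is dropped.
-- In a complete multipartite graph with at least two nonempty parts any three
-- vertices lie in a common closed neighbourhood (that of one of them if two lie in
-- different parts, otherwise that of a vertex in another part), so a packing has at
-- most two vertices, while any two vertices form one.
module Submission where

open import Defs
open import Data.Nat using (ℕ; _≤_; _/_; _*_; _+_)
open import Data.Fin using (Fin) renaming (_≤_ to _≤ᶠ_)
open import Data.Vec using (Vec; lookup; sum)
open import Data.Product using (_×_)

open import Data.Bool using (Bool; true; false; T; _∧_; _∨_; not)
open import Data.Bool.Properties using (T-≡; T-∧; T-∨; ∨-assoc; ∧-identityʳ; ∧-zeroʳ)
open import Data.Empty using (⊥; ⊥-elim)
open import Data.Fin as F using (toℕ; fromℕ<; _↑ʳ_)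
open import Data.Fin.Properties using (toℕ-fromℕ<; toℕ-injective; splitAt-↑ʳ)
open import Data.Fin.Subset using (Subset; ∣_∣; _∩_; inside) renaming (⊥ to ∅)
open import Data.Fin.Subset.Properties using (∣p∣≤n; ∣p∩q∣≤∣q∣; ∣⊥∣≡0)
open import Data.Nat using (zero; suc; _<_; _∸_; _≡ᵇ_; _<ᵇ_; z≤n; s≤s; s≤s⁻¹; _≤?_)
open import Data.Nat.Divisibility using (divides)
open import Data.Nat.DivMod using (m*n/n≡m; /-monoˡ-≤; +-distrib-/-∣ʳ)
open import Data.Nat.Properties
open import Algebra.Properties.CommutativeSemigroup +-commutativeSemigroup using (interchange)
open import Data.Nat.Tactic.RingSolver using (solve-∀)
open import Data.Product using (Σ; ∃-syntax; _,_; proj₁; proj₂)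
open import Data.Sum using (_⊎_; inj₁; inj₂; [_,_])
open import Data.Unit using (tt)
open import Data.Vec using ([]; _∷_; tabulate)
open import Data.Vec.Properties using (lookup∘tabulate)
open import Function using (_∘_)
open import Function.Bundles using (Equivalence)
open import Relation.Nullary using (¬_; yes; no)
open import Relation.Binary.PropositionalEquality using (_≡_; _≢_; refl; sym; trans; cong; cong₂; subst; module ≡-Reasoning)

open Equivalence using (to; from)

⟦_⟧ : Bool → ℕ
⟦ true  ⟧ = 1
⟦ false ⟧ = 0

⟦⟧≤1 : ∀ b → ⟦ b ⟧ ≤ 1
⟦⟧≤1 true  = ≤-refl
⟦⟧≤1 false = z≤n

T⇒⟦⟧≡1 : ∀ {b} → T b → ⟦ b ⟧ ≡ 1
T⇒⟦⟧≡1 {true} _ = refl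

≢⇒T-not-≡ᵇ : ∀ {m n} → m ≢ n → T (not (m ≡ᵇ n))
≢⇒T-not-≡ᵇ {m} {n} m≢n with m ≡ᵇ n in eq
... | true  = ⊥-elim (m≢n (≡ᵇ⇒≡ m n (subst T (sym eq) tt)))
... | false = tt

n<ᵇn≡false : ∀ n → (n <ᵇ n) ≡ false
n<ᵇn≡false zero    = refl
n<ᵇn≡false (suc n) = n<ᵇn≡false n

3*m≤n⇒m≤n/3 : ∀ {m n} → 3 * m ≤ n → m ≤ n / 3
3*m≤n⇒m≤n/3 {m} {n} 3m≤n =
  subst (_≤ n / 3) (m*n/n≡m m 3) (/-monoˡ-≤ 3 (subst (_≤ n) (*-comm 3 m) 3m≤n))

∑ : ℕ → (ℕ → ℕ) → ℕ
∑ zero    f = 0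
∑ (suc n) f = ∑ n f + f n

syntax ∑ n (λ i → e) = ∑[ i < n ] e

∑-shift : ∀ n (f : ℕ → ℕ) → ∑ (suc n) f ≡ f 0 + ∑[ i < n ] f (suc i)
∑-shift zero    f = +-comm 0 (f 0)
∑-shift (suc n) f = trans (cong (_+ f (suc n)) (∑-shift n f)) (+-assoc (f 0) _ _)

∑-+ : ∀ n (f g : ℕ → ℕ) → ∑[ i < n ] (f i + g i) ≡ ∑ n f + ∑ n g
∑-+ zero    f g = refl
∑-+ (suc n) f g =
  trans (cong (_+ (f n + g n)) (∑-+ n f g)) (interchange (∑ n f) (∑ n g) (f n) (g n))

∑-cong : ∀ n {f g : ℕ → ℕ} → (∀ {i} → i < n → f i ≡ g i) → ∑ n f ≡ ∑ n g
∑-cong zero    f≡g = refl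
∑-cong (suc n) f≡g = cong₂ _+_ (∑-cong n (f≡g ∘ m<n⇒m<1+n)) (f≡g ≤-refl)

∑-mono-≤ : ∀ n {f g : ℕ → ℕ} → (∀ {i} → i < n → f i ≤ g i) → ∑ n f ≤ ∑ n g
∑-mono-≤ zero    f≤g = z≤n
∑-mono-≤ (suc n) f≤g = +-mono-≤ (∑-mono-≤ n (f≤g ∘ m<n⇒m<1+n)) (f≤g ≤-refl)

∑-const : ∀ n k → ∑[ i < n ] k ≡ n * k
∑-const zero    k = refl
∑-const (suc n) k = trans (cong (_+ k) (∑-const n k)) (+-comm (n * k) k)

∑-prefix-≤ : ∀ (f : ℕ → ℕ) {m n} → m ≤ n → ∑ m f ≤ ∑ n f
∑-prefix-≤ f {n = zero}  z≤n = ≤-refl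
∑-prefix-≤ f {m} {suc n} m≤1+n with m≤n⇒m<n∨m≡n m≤1+n
... | inj₁ m<1+n = ≤-trans (∑-prefix-≤ f (s≤s⁻¹ m<1+n)) (m≤m+n (∑ n f) (f n))
... | inj₂ refl  = ≤-refl

three≤∑ : ∀ (f : ℕ → ℕ) {x y z n} → x < y → y < z → z < n → f x + f y + f z ≤ ∑ n f
three≤∑ f {x} {y} {z} {n} x<y y<z z<n = begin
  f x + f y + f z  ≤⟨ +-monoˡ-≤ (f z) (+-monoˡ-≤ (f y) fx≤∑y) ⟩
  ∑ y f + f y + f z ≤⟨ +-monoˡ-≤ (f z) (∑-prefix-≤ f y<z) ⟩
  ∑ z f + f z       ≤⟨ ∑-prefix-≤ f z<n ⟩
  ∑ n f             ∎
  where
  open ≤-Reasoning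
  fx≤∑y : f x ≤ ∑ y f
  fx≤∑y = ≤-trans (m≤n+m (f x) (∑ x f)) (∑-prefix-≤ f x<y)

<∑⟦⟧⇒∃ : ∀ (b : ℕ → Bool) n {k} → k < ∑[ i < n ] ⟦ b i ⟧
        → ∃[ x ] x < n × T (b x) × k ≤ ∑[ i < x ] ⟦ b i ⟧
<∑⟦⟧⇒∃ b (suc n) {k} k<∑ with b n in bn
... | true  = n , ≤-refl , subst T (sym bn) tt , s≤s⁻¹ (subst (k <_) (+-comm _ 1) k<∑)
... | false with <∑⟦⟧⇒∃ b n (subst (k <_) (+-identityʳ _) k<∑)
...   | x , x<n , bx , k≤∑x = x , m<n⇒m<1+n x<n , bx , k≤∑x

window : (ℕ → ℕ) → ℕ → ℕ
window c j = c j + c (suc j) + c (suc (suc j))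

-- The n = m + 2 closed neighbourhoods of the cycle 0, 1, …, m + 1: the m windows
-- centred at 1, …, m, then those of m + 1 and of 0.  Each vertex lies in three of them.
∑-windows : ∀ (c : ℕ → ℕ) m
          → ∑[ j < m ] window c j + (c 0 + c m + c (suc m)) + (c 0 + c 1 + c (suc m))
            ≡ 3 * ∑ (suc (suc m)) c
∑-windows c m = begin
  ∑[ j < m ] window c j + (c 0 + c m + c (suc m)) + (c 0 + c 1 + c (suc m))
    ≡⟨ cong (λ s → s + (c 0 + c m + c (suc m)) + (c 0 + c 1 + c (suc m))) ∑-window ⟩
  S₀ + S₁ + S₂ + (c 0 + c m + c (suc m)) + (c 0 + c 1 + c (suc m))
    ≡⟨ regroup S₀ S₁ S₂ (c 0) (c 1) (c m) (c (suc m)) ⟩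
  X + ((c 0 + (S₁ + c (suc m))) + ((c 0 + (c 1 + S₂)) + 0))
    ≡⟨ cong₂ (λ s s′ → X + (s + (s′ + 0))) (sym dropFirst) (sym dropFirstTwo) ⟩
  3 * X ∎
  where
  open ≡-Reasoning
  X  = ∑ (suc (suc m)) c
  S₀ = ∑ m c
  S₁ = ∑[ i < m ] c (suc i)
  S₂ = ∑[ i < m ] c (suc (suc i))
  ∑-window : ∑[ j < m ] window c j ≡ S₀ + S₁ + S₂
  ∑-window = trans (∑-+ m (λ j → c j + c (suc j)) (λ j → c (suc (suc j))))
                   (cong (_+ S₂) (∑-+ m c (c ∘ suc)))
  dropFirst : X ≡ c 0 + (S₁ + c (suc m))
  dropFirst = ∑-shift (suc m) c
  dropFirstTwo : X ≡ c 0 + (c 1 + S₂)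
  dropFirstTwo = trans (∑-shift (suc m) c) (cong (c 0 +_) (∑-shift m (c ∘ suc)))
  regroup : ∀ s₀ s₁ s₂ a₀ a₁ aₘ aₘ₁
          → s₀ + s₁ + s₂ + (a₀ + aₘ + aₘ₁) + (a₀ + a₁ + aₘ₁)
            ≡ (s₀ + aₘ + aₘ₁) + ((a₀ + (s₁ + aₘ₁)) + ((a₀ + (a₁ + s₂)) + 0))
  regroup = solve-∀

3*∑≤2*[m+k] : ∀ (c : ℕ → ℕ) m k → (∀ {j} → j < m → window c j ≤ 2)
            → c 0 + c m + c (suc m) ≤ k → c 0 + c 1 + c (suc m) ≤ k
            → 3 * ∑ (suc (suc m)) c ≤ 2 * (m + k)
3*∑≤2*[m+k] c m k windows≤2 last≤k first≤k = begin
  3 * ∑ (suc (suc m)) c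
    ≡⟨ sym (∑-windows c m) ⟩
  ∑[ j < m ] window c j + (c 0 + c m + c (suc m)) + (c 0 + c 1 + c (suc m))
    ≤⟨ +-mono-≤ (+-mono-≤ (∑-mono-≤ m windows≤2) last≤k) first≤k ⟩
  ∑[ j < m ] 2 + k + k
    ≡⟨ cong (λ s → s + k + k) (∑-const m 2) ⟩
  m * 2 + k + k
    ≡⟨ double m k ⟩
  2 * (m + k) ∎
  where
  open ≤-Reasoning
  double : ∀ m k → m * 2 + k + k ≡ 2 * (m + k)
  double = solve-∀

-- Subsets of Fin N as predicates on ℕ

member : ∀ {N} → Subset N → ℕ → Bool
member []      _       = false
member (b ∷ B) zero    = b
member (b ∷ B) (suc x) = member B x

member⇒< : ∀ {N} (B : Subset N) {x} → T (member B x) → x < N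
member⇒< (b ∷ B) {zero}  _  = s≤s z≤n
member⇒< (b ∷ B) {suc x} Bx = s≤s (member⇒< B Bx)

member-∩ : ∀ {N} (B C : Subset N) x → member (B ∩ C) x ≡ member B x ∧ member C x
member-∩ []      []      x       = refl
member-∩ (b ∷ B) (c ∷ C) zero    = refl
member-∩ (b ∷ B) (c ∷ C) (suc x) = member-∩ B C x

member-lookup : ∀ {N} (B : Subset N) (u : Fin N) → member B (toℕ u) ≡ lookup B u
member-lookup (b ∷ B) F.zero    = refl
member-lookup (b ∷ B) (F.suc u) = member-lookup B u

∣∣≡∑member : ∀ {N} (B : Subset N) → ∣ B ∣ ≡ ∑[ x < N ] ⟦ member B x ⟧
∣∣≡∑member []              = refl
∣∣≡∑member {suc N} (b ∷ B) = trans (cons b) (sym (∑-shift N (⟦_⟧ ∘ member (b ∷ B))))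
  where
  cons : ∀ b → ∣ b ∷ B ∣ ≡ ⟦ b ⟧ + ∑[ x < N ] ⟦ member B x ⟧
  cons true  = cong suc (∣∣≡∑member B)
  cons false = ∣∣≡∑member B

toSubset : ∀ {N} → (ℕ → Bool) → Subset N
toSubset s = tabulate (s ∘ toℕ)

member-toSubset : ∀ {N} (s : ℕ → Bool) {x} → x < N → member (toSubset {N} s) x ≡ s x
member-toSubset {suc N} s {zero}  _         = refl
member-toSubset {suc N} s {suc x} (s≤s x<N) = member-toSubset (s ∘ suc) x<N

∣toSubset∣ : ∀ N (s : ℕ → Bool) → ∣ toSubset {N} s ∣ ≡ ∑[ x < N ] ⟦ s x ⟧
∣toSubset∣ N s =
  trans (∣∣≡∑member (toSubset {N} s)) (∑-cong N (cong ⟦_⟧ ∘ member-toSubset s))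

subsetOfSize : ∀ {k N} → k ≤ N → Σ (Subset N) (λ W → ∣ W ∣ ≡ k)
subsetOfSize {N = N} z≤n = ∅ , ∣⊥∣≡0 N
subsetOfSize (s≤s k≤N) with subsetOfSize k≤N
... | W , ∣W∣≡k = inside ∷ W , cong suc ∣W∣≡k

record Three (P : ℕ → Bool) : Set where
  constructor three
  field
    {x y z} : ℕ
    x<y : x < y
    y<z : y < z
    Px  : T (P x)
    Py  : T (P y)
    Pz  : T (P z)

Three-map : ∀ {P Q : ℕ → Bool} → (∀ {x} → T (P x) → T (Q x)) → Three P → Three Q
Three-map P⇒Q (three x<y y<z Px Py Pz) = three x<y y<z (P⇒Q Px) (P⇒Q Py) (P⇒Q Pz)

3≤∣∣⇒Three : ∀ {N} (B : Subset N) → 3 ≤ ∣ B ∣ → Three (member B)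
3≤∣∣⇒Three {N} B 3≤∣B∣ with <∑⟦⟧⇒∃ (member B) N (subst (3 ≤_) (∣∣≡∑member B) 3≤∣B∣)
... | z , _ , Bz , 2<∑z with <∑⟦⟧⇒∃ (member B) z 2<∑z
... | y , y<z , By , 1<∑y with <∑⟦⟧⇒∃ (member B) y 1<∑y
... | x , x<y , Bx , _ = three x<y y<z Bx By Bz

¬Three⇒∣∣≤2 : ∀ {N} (B : Subset N) → ¬ Three (member B) → ∣ B ∣ ≤ 2
¬Three⇒∣∣≤2 B ¬three with ∣ B ∣ ≤? 2
... | yes ∣B∣≤2 = ∣B∣≤2
... | no  ∣B∣≰2 = ⊥-elim (¬three (3≤∣∣⇒Three B (≰⇒> ∣B∣≰2)))

Three-∣∩∣ : ∀ {N} (B A : Subset N) (t : Three (member B))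
          → let open Three t in ⟦ member A x ⟧ + ⟦ member A y ⟧ + ⟦ member A z ⟧ ≤ ∣ B ∩ A ∣
Three-∣∩∣ {N} B A (three {x} {y} {z} x<y y<z Bx By Bz) = begin
  ⟦ member A x ⟧ + ⟦ member A y ⟧ + ⟦ member A z ⟧
    ≡⟨ sym (cong₂ _+_ (cong₂ _+_ (inB Bx) (inB By)) (inB Bz)) ⟩
  c x + c y + c z
    ≤⟨ three≤∑ c x<y y<z (member⇒< B Bz) ⟩
  ∑ N c
    ≡⟨ sym (∣∣≡∑member (B ∩ A)) ⟩
  ∣ B ∩ A ∣ ∎
  where
  open ≤-Reasoning
  c = λ i → ⟦ member (B ∩ A) i ⟧
  inB : ∀ {i} → T (member B i) → c i ≡ ⟦ member A i ⟧
  inB {i} Bi = cong ⟦_⟧ (trans (member-∩ B A i) (cong (_∧ member A i) (to T-≡ Bi)))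

∣∣≤2⇒packing : ∀ {N} (G : Graph N) {A : Subset N} → ∣ A ∣ ≤ 2 → IsTwoNeighbourPacking G A
∣∣≤2⇒packing G {A} ∣A∣≤2 v = ≤-trans (∣p∩q∣≤∣q∣ (closedNbhd G v) A) ∣A∣≤2

CommonClosedNbhd : ∀ {N} → Graph N → Fin N → Fin N → Fin N → Set
CommonClosedNbhd G u v w =
  ∃[ c ] T (lookup (closedNbhd G c) u) × T (lookup (closedNbhd G c) v) × T (lookup (closedNbhd G c) w)

common⇒packing≤2 : ∀ {N} (G : Graph N) → (∀ u v w → CommonClosedNbhd G u v w)
                 → (A : Subset N) → IsTwoNeighbourPacking G A → ∣ A ∣ ≤ 2
common⇒packing≤2 {N} G common A packing = ¬Three⇒∣∣≤2 A ¬three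
  where
  vertex : ∀ {i} → T (member A i) → Fin N
  vertex Ai = fromℕ< (member⇒< A Ai)
  ¬three : ¬ Three (member A)
  ¬three (three {x} {y} {z} x<y y<z Ax Ay Az) with common (vertex Ax) (vertex Ay) (vertex Az)
  ... | c , cx , cy , cz = 1+n≰n (≤-trans 3≤∣N[c]∩A∣ (packing c))
    where
    inN[c] : ∀ {i} (Ai : T (member A i))
           → T (lookup (closedNbhd G c) (vertex Ai)) → T (member (closedNbhd G c) i)
    inN[c] {i} Ai = subst T (trans (sym (member-lookup (closedNbhd G c) (vertex Ai)))
                                   (cong (member (closedNbhd G c)) (toℕ-fromℕ< (member⇒< A Ai))))
    3≤∣N[c]∩A∣ : 3 ≤ ∣ closedNbhd G c ∩ A ∣
    3≤∣N[c]∩A∣ = subst (_≤ ∣ closedNbhd G c ∩ A ∣)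
                   (cong₂ _+_ (cong₂ _+_ (T⇒⟦⟧≡1 Ax) (T⇒⟦⟧≡1 Ay)) (T⇒⟦⟧≡1 Az))
                   (Three-∣∩∣ (closedNbhd G c) A
                      (three x<y y<z (inN[c] Ax cx) (inN[c] Ay cy) (inN[c] Az cz)))

-- pathGraph n is labelGraph adjNat, and closedNbhd (labelGraph H) v is
-- toSubset (nbhd H (toℕ v)), both by definition.
labelGraph : ∀ {N} → (ℕ → ℕ → Bool) → Graph N
labelGraph H i j = H (toℕ i) (toℕ j)

nbhd : (ℕ → ℕ → Bool) → ℕ → ℕ → Bool
nbhd H t x = (x ≡ᵇ t) ∨ H t x

nbhd-self : ∀ H t → T (nbhd H t t)
nbhd-self H t = from (T-∨ {t ≡ᵇ t} {H t t}) (inj₁ (≡⇒≡ᵇ t t refl))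

adj⇒nbhd : ∀ H t x → T (H t x) → T (nbhd H t x)
adj⇒nbhd H t x = from (T-∨ {x ≡ᵇ t} {H t x}) ∘ inj₂

labelGraph-window≤2 : ∀ {N} H {t} (A : Subset N) → IsTwoNeighbourPacking (labelGraph H) A
                    → t < N → (w : Three (nbhd H t)) → Three.z w < N
                    → let open Three w in ⟦ member A x ⟧ + ⟦ member A y ⟧ + ⟦ member A z ⟧ ≤ 2
labelGraph-window≤2 {N} H {t} A packing t<N (three x<y y<z Px Py Pz) z<N =
  ≤-trans (Three-∣∩∣ (closedNbhd (labelGraph H) v) A
             (three x<y y<z (inN[t] (<-trans x<y y<N) Px) (inN[t] y<N Py) (inN[t] z<N Pz)))
          (packing v)
  where
  v = fromℕ< t<N
  y<N = <-trans y<z z<N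
  inN[t] : ∀ {i} → i < N → T (nbhd H t i) → T (member (closedNbhd (labelGraph H) v) i)
  inN[t] {i} i<N = subst T (sym (trans (member-toSubset (nbhd H (toℕ v)) i<N)
                                       (cong (λ s → nbhd H s i) (toℕ-fromℕ< t<N))))

labelGraph-packing : ∀ {N} H (s : ℕ → Bool) → (∀ t → ¬ Three (λ x → nbhd H t x ∧ s x))
                   → IsTwoNeighbourPacking (labelGraph {N} H) (toSubset s)
labelGraph-packing {N} H s ¬three v =
  ¬Three⇒∣∣≤2 (N[v] ∩ toSubset s) (¬three (toℕ v) ∘ Three-map restrict)
  where
  N[v] = closedNbhd (labelGraph H) v
  restrict : ∀ {x} → T (member (N[v] ∩ toSubset s) x) → T (nbhd H (toℕ v) x ∧ s x)
  restrict {x} h = subst T (trans (member-∩ N[v] (toSubset s) x)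
                                  (cong₂ _∧_ (member-toSubset {N} (nbhd H (toℕ v)) x<N)
                                             (member-toSubset s x<N))) h
    where
    x<N = member⇒< (N[v] ∩ toSubset s) h

Near : ℕ → ℕ → Set
Near t x = t ≤ suc x × x ≤ suc t

adjNat-suc : ∀ t → T (adjNat t (suc t))
adjNat-suc t = from T-∨ (inj₁ (≡⇒≡ᵇ (t + 1) (suc t) (+-comm t 1)))

adjNat-pred : ∀ t → T (adjNat (suc t) t)
adjNat-pred t = from T-∨ (inj₂ (≡⇒≡ᵇ (t + 1) (suc t) (+-comm t 1)))

nbhd-adjNat⇒Near : ∀ t x → T (nbhd adjNat t x) → Near t x
nbhd-adjNat⇒Near t x h with to T-∨ h
... | inj₁ x≡t = subst (Near t) (sym (≡ᵇ⇒≡ x t x≡t)) (n≤1+n t , n≤1+n t)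
... | inj₂ adj with to T-∨ adj
...   | inj₁ 1+t≡x = subst (Near t) (trans (+-comm 1 t) (≡ᵇ⇒≡ (t + 1) x 1+t≡x))
                           (≤-trans (n≤1+n t) (n≤1+n (suc t)) , ≤-refl)
...   | inj₂ 1+x≡t = subst (λ s → Near s x) (trans (+-comm 1 x) (≡ᵇ⇒≡ (x + 1) t 1+x≡t))
                           (≤-refl , ≤-trans (n≤1+n x) (n≤1+n (suc x)))

Near-consecutive : ∀ {t x y z} → x < y → y < z → Near t x → Near t z → y ≡ suc x × z ≡ suc y
Near-consecutive x<y y<z (t≤1+x , _) (_ , z≤1+t) =
  ≤-antisym (s≤s⁻¹ (≤-trans y<z z≤2+x)) x<y , ≤-antisym (≤-trans z≤2+x (s≤s x<y)) y<z
  where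
  z≤2+x = ≤-trans z≤1+t (s≤s t≤1+x)

path-window : ∀ j → Three (nbhd adjNat (suc j))
path-window j = three {x = j} {y = suc j} {z = suc (suc j)} ≤-refl ≤-refl
  (adj⇒nbhd adjNat (suc j) j (adjNat-pred j))
  (nbhd-self adjNat (suc j))
  (adj⇒nbhd adjNat (suc j) (suc (suc j)) (adjNat-suc (suc j)))

notTwoMod3 : ℕ → Bool
notTwoMod3 0                   = true
notTwoMod3 1                   = true
notTwoMod3 2                   = false
notTwoMod3 (suc (suc (suc x))) = notTwoMod3 x

window-notTwoMod3 : ∀ x → window (⟦_⟧ ∘ notTwoMod3) x ≡ 2
window-notTwoMod3 0                   = refl
window-notTwoMod3 1                   = refl
window-notTwoMod3 2                   = refl
window-notTwoMod3 (suc (suc (suc x))) = window-notTwoMod3 x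

notTwoMod3-¬consecutive : ∀ x → T (notTwoMod3 x) → T (notTwoMod3 (suc x))
                        → T (notTwoMod3 (suc (suc x))) → ⊥
notTwoMod3-¬consecutive 0                   _ _ ()
notTwoMod3-¬consecutive 1                   _ () _
notTwoMod3-¬consecutive 2                   () _ _
notTwoMod3-¬consecutive (suc (suc (suc x))) = notTwoMod3-¬consecutive x

notTwoMod3-¬Near : ∀ {t x y z} → x < y → y < z → Near t x → Near t z
                 → T (notTwoMod3 x) → T (notTwoMod3 y) → T (notTwoMod3 z) → ⊥
notTwoMod3-¬Near {x = x} x<y y<z near-x near-z with Near-consecutive x<y y<z near-x near-z
... | refl , refl = notTwoMod3-¬consecutive x

∑-notTwoMod3 : ∀ n → ∑[ x < n ] ⟦ notTwoMod3 x ⟧ ≡ (2 * n + 2) / 3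
∑-notTwoMod3 0 = refl
∑-notTwoMod3 1 = refl
∑-notTwoMod3 2 = refl
∑-notTwoMod3 (suc (suc (suc n))) = begin
  ∑ n f + f n + f (suc n) + f (suc (suc n))
    ≡⟨ trans (cong (_+ f (suc (suc n))) (+-assoc (∑ n f) (f n) (f (suc n))))
             (+-assoc (∑ n f) _ _) ⟩
  ∑ n f + window f n
    ≡⟨ cong₂ _+_ (∑-notTwoMod3 n) (window-notTwoMod3 n) ⟩
  (2 * n + 2) / 3 + 6 / 3
    ≡⟨ sym (+-distrib-/-∣ʳ (2 * n + 2) (divides 2 refl)) ⟩
  (2 * n + 2 + 6) / 3
    ≡⟨ cong (_/ 3) (shift n) ⟩
  (2 * (3 + n) + 2) / 3 ∎
  where
  open ≡-Reasoning
  f = ⟦_⟧ ∘ notTwoMod3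
  shift : ∀ n → 2 * n + 2 + 6 ≡ 2 * (3 + n) + 2
  shift = solve-∀

path-¬Three : ∀ t → ¬ Three (λ x → nbhd adjNat t x ∧ notTwoMod3 x)
path-¬Three t (three {x} {y} {z} x<y y<z Px Py Pz) =
  notTwoMod3-¬Near x<y y<z (near x Px) (near z Pz) (kept x Px) (kept y Py) (kept z Pz)
  where
  near : ∀ i → T (nbhd adjNat t i ∧ notTwoMod3 i) → Near t i
  near i = nbhd-adjNat⇒Near t i ∘ proj₁ ∘ to T-∧
  kept : ∀ i → T (nbhd adjNat t i ∧ notTwoMod3 i) → T (notTwoMod3 i)
  kept i = proj₂ ∘ to T-∧

path-packing≤ : ∀ n → 1 ≤ n → (A : Subset n) → IsTwoNeighbourPacking (pathGraph n) A
              → ∣ A ∣ ≤ (2 * n + 2) / 3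
path-packing≤ 1             _ A _       = ∣p∣≤n A
path-packing≤ (suc (suc m)) _ A packing = 3*m≤n⇒m≤n/3 (begin
  3 * ∣ A ∣             ≡⟨ cong (3 *_) (∣∣≡∑member A) ⟩
  3 * ∑ (suc (suc m)) c ≤⟨ 3*∑≤2*[m+k] c m 3 windows≤2
                              (ends (member A 0) (member A m) (member A (suc m)))
                              (ends (member A 0) (member A 1) (member A (suc m))) ⟩
  2 * (m + 3)           ≡⟨ arith m ⟩
  2 * (2 + m) + 2       ∎)
  where
  open ≤-Reasoning
  c = λ x → ⟦ member A x ⟧
  windows≤2 : ∀ {j} → j < m → window c j ≤ 2
  windows≤2 {j} j<m =
    labelGraph-window≤2 adjNat A packing (s≤s (s≤s (<⇒≤ j<m))) (path-window j) (s≤s (s≤s j<m))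
  ends : ∀ a b d → ⟦ a ⟧ + ⟦ b ⟧ + ⟦ d ⟧ ≤ 3
  ends a b d = +-mono-≤ (+-mono-≤ (⟦⟧≤1 a) (⟦⟧≤1 b)) (⟦⟧≤1 d)
  arith : ∀ m → 2 * (m + 3) ≡ 2 * (2 + m) + 2
  arith = solve-∀

path-twoPackingNumber : ∀ n → 1 ≤ n → TwoPackingNumberIs (pathGraph n) ((2 * n + 2) / 3)
path-twoPackingNumber n 1≤n =
  (toSubset notTwoMod3 , labelGraph-packing adjNat notTwoMod3 path-¬Three ,
   trans (∣toSubset∣ n notTwoMod3) (∑-notTwoMod3 n)) ,
  path-packing≤ n 1≤n

wrapAdj : ℕ → ℕ → ℕ → Bool
wrapAdj n a b = ((a ≡ᵇ 0) ∧ (b ≡ᵇ (n ∸ 1))) ∨ ((b ≡ᵇ 0) ∧ (a ≡ᵇ (n ∸ 1)))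

-- cycleGraph n is labelGraph (cycleAdj n) by definition.
cycleAdj : ℕ → ℕ → ℕ → Bool
cycleAdj n a b = adjNat a b ∨ wrapAdj n a b

nbhd-cycleAdj : ∀ n t x → nbhd (cycleAdj n) t x ≡ nbhd adjNat t x ∨ wrapAdj n t x
nbhd-cycleAdj n t x = sym (∨-assoc (x ≡ᵇ t) (adjNat t x) (wrapAdj n t x))

nbhd-adjNat⇒nbhd-cycleAdj : ∀ n t x → T (nbhd adjNat t x) → T (nbhd (cycleAdj n) t x)
nbhd-adjNat⇒nbhd-cycleAdj n t x =
  subst T (sym (nbhd-cycleAdj n t x)) ∘ from (T-∨ {nbhd adjNat t x} {wrapAdj n t x}) ∘ inj₁

wrap⇒nbhd-cycleAdj : ∀ n t x → T (wrapAdj n t x) → T (nbhd (cycleAdj n) t x)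
wrap⇒nbhd-cycleAdj n t x =
  subst T (sym (nbhd-cycleAdj n t x)) ∘ from (T-∨ {nbhd adjNat t x} {wrapAdj n t x}) ∘ inj₂

nbhd-cycleAdj⇒Near : ∀ m t x → T (nbhd (cycleAdj (suc m)) t x) → x < m
                    → Near t x ⊎ (x ≡ 0 × t ≡ m)
nbhd-cycleAdj⇒Near m t x h x<m with to T-∨ (subst T (nbhd-cycleAdj (suc m) t x) h)
... | inj₁ path = inj₁ (nbhd-adjNat⇒Near t x path)
... | inj₂ wrap with to T-∨ wrap
...   | inj₁ t≡0∧x≡m = ⊥-elim (<-irrefl (≡ᵇ⇒≡ x m (proj₂ (to T-∧ t≡0∧x≡m))) x<m)
...   | inj₂ x≡0∧t≡m =
  inj₂ (≡ᵇ⇒≡ x 0 (proj₁ (to T-∧ x≡0∧t≡m)) , ≡ᵇ⇒≡ t m (proj₂ (to T-∧ x≡0∧t≡m)))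

cycle-window₀ : ∀ m → 1 ≤ m → Three (nbhd (cycleAdj (suc (suc m))) 0)
cycle-window₀ m 1≤m = three {x = 0} {y = 1} {z = suc m} ≤-refl (s≤s 1≤m)
  (nbhd-self (cycleAdj (suc (suc m))) 0)
  (nbhd-adjNat⇒nbhd-cycleAdj (suc (suc m)) 0 1 (adj⇒nbhd adjNat 0 1 (adjNat-suc 0)))
  (wrap⇒nbhd-cycleAdj (suc (suc m)) 0 (suc m)
     (from (T-∨ {m ≡ᵇ m} {false}) (inj₁ (≡⇒≡ᵇ m m refl))))

cycle-windowₘ : ∀ m → 1 ≤ m → Three (nbhd (cycleAdj (suc (suc m))) (suc m))
cycle-windowₘ m 1≤m = three {x = 0} {y = m} {z = suc m} 1≤m ≤-refl
  (wrap⇒nbhd-cycleAdj (suc (suc m)) (suc m) 0 (≡⇒≡ᵇ m m refl))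
  (nbhd-adjNat⇒nbhd-cycleAdj (suc (suc m)) (suc m) m
     (adj⇒nbhd adjNat (suc m) m (adjNat-pred m)))
  (nbhd-self (cycleAdj (suc (suc m))) (suc m))

notTwoMod3Below : ℕ → ℕ → Bool
notTwoMod3Below m x = notTwoMod3 x ∧ (x <ᵇ m)

∑-notTwoMod3Below : ∀ m → ∑[ x < suc m ] ⟦ notTwoMod3Below m x ⟧ ≡ (2 * suc m) / 3
∑-notTwoMod3Below m = begin
  ∑[ x < m ] ⟦ notTwoMod3Below m x ⟧ + ⟦ notTwoMod3Below m m ⟧
    ≡⟨ cong₂ _+_ (∑-cong m below) (cong ⟦_⟧ dropped) ⟩
  ∑[ x < m ] ⟦ notTwoMod3 x ⟧ + 0
    ≡⟨ +-identityʳ _ ⟩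
  ∑[ x < m ] ⟦ notTwoMod3 x ⟧
    ≡⟨ ∑-notTwoMod3 m ⟩
  (2 * m + 2) / 3
    ≡⟨ cong (_/ 3) (trans (+-comm (2 * m) 2) (sym (*-suc 2 m))) ⟩
  (2 * suc m) / 3 ∎
  where
  open ≡-Reasoning
  below : ∀ {x} → x < m → ⟦ notTwoMod3Below m x ⟧ ≡ ⟦ notTwoMod3 x ⟧
  below {x} x<m = cong ⟦_⟧ (trans (cong (notTwoMod3 x ∧_) (to T-≡ (<⇒<ᵇ x<m))) (∧-identityʳ _))
  dropped : notTwoMod3Below m m ≡ false
  dropped = trans (cong (notTwoMod3 m ∧_) (n<ᵇn≡false m)) (∧-zeroʳ _)

cycle-¬Three : ∀ m t → ¬ Three (λ x → nbhd (cycleAdj (suc m)) t x ∧ notTwoMod3Below m x)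
cycle-¬Three m t (three {x} {y} {z} x<y y<z Px Py Pz) = [ inner , wrap ] (near-or-wrap x Px)
  where
  P = λ i → nbhd (cycleAdj (suc m)) t i ∧ notTwoMod3Below m i
  facts : ∀ i → T (P i) → T (nbhd (cycleAdj (suc m)) t i) × T (notTwoMod3 i) × i < m
  facts i Pi with to (T-∧ {nbhd (cycleAdj (suc m)) t i} {notTwoMod3Below m i}) Pi
  ... | adj , kept-below with to (T-∧ {notTwoMod3 i} {i <ᵇ m}) kept-below
  ...   | kept , below = adj , kept , <ᵇ⇒< i m below
  near-or-wrap : ∀ i → T (P i) → Near t i ⊎ (i ≡ 0 × t ≡ m)
  near-or-wrap i Pi = nbhd-cycleAdj⇒Near m t i (proj₁ (facts i Pi)) (proj₂ (proj₂ (facts i Pi)))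
  near : ∀ i → 0 < i → T (P i) → Near t i
  near i 0<i Pi with near-or-wrap i Pi
  ... | inj₁ near-i     = near-i
  ... | inj₂ (refl , _) = ⊥-elim (<-irrefl refl 0<i)
  kept : ∀ i → T (P i) → T (notTwoMod3 i)
  kept i = proj₁ ∘ proj₂ ∘ facts i
  0<y : 0 < y
  0<y = ≤-trans (s≤s z≤n) x<y
  inner : Near t x → ⊥
  inner near-x = notTwoMod3-¬Near x<y y<z near-x (near z (<-trans 0<y y<z) Pz)
                                  (kept x Px) (kept y Py) (kept z Pz)
  wrap : x ≡ 0 × t ≡ m → ⊥
  wrap (_ , t≡m) =
    <-irrefl t≡m (≤-<-trans (≤-trans (proj₁ (near y 0<y Py)) y<z) (proj₂ (proj₂ (facts z Pz))))

cycle-packing≤ : ∀ m → 1 ≤ m → (A : Subset (suc (suc m)))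
               → IsTwoNeighbourPacking (cycleGraph (suc (suc m))) A → ∣ A ∣ ≤ (2 * suc (suc m)) / 3
cycle-packing≤ m 1≤m A packing = 3*m≤n⇒m≤n/3 (begin
  3 * ∣ A ∣             ≡⟨ cong (3 *_) (∣∣≡∑member A) ⟩
  3 * ∑ (suc (suc m)) c ≤⟨ 3*∑≤2*[m+k] c m 2 windows≤2
                              (window≤2 ≤-refl (cycle-windowₘ m 1≤m) ≤-refl)
                              (window≤2 (s≤s z≤n) (cycle-window₀ m 1≤m) ≤-refl) ⟩
  2 * (m + 2)           ≡⟨ cong (2 *_) (+-comm m 2) ⟩
  2 * (2 + m)           ∎)
  where
  open ≤-Reasoning
  H = cycleAdj (suc (suc m))
  c = λ x → ⟦ member A x ⟧
  window≤2 : ∀ {t} → t < suc (suc m) → (w : Three (nbhd H t)) → Three.z w < suc (suc m)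
           → let open Three w in c x + c y + c z ≤ 2
  window≤2 = labelGraph-window≤2 H A packing
  windows≤2 : ∀ {j} → j < m → window c j ≤ 2
  windows≤2 {j} j<m =
    window≤2 (s≤s (s≤s (<⇒≤ j<m)))
             (Three-map (λ {i} → nbhd-adjNat⇒nbhd-cycleAdj (suc (suc m)) (suc j) i) (path-window j))
             (s≤s (s≤s j<m))

cycle-twoPackingNumber : ∀ n → 3 ≤ n → TwoPackingNumberIs (cycleGraph n) ((2 * n) / 3)
cycle-twoPackingNumber 1 (s≤s ())
cycle-twoPackingNumber 2 (s≤s (s≤s ()))
cycle-twoPackingNumber (suc (suc (suc k))) _ =
  (toSubset (notTwoMod3Below m) ,
   labelGraph-packing (cycleAdj (suc m)) (notTwoMod3Below m) (cycle-¬Three m) ,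
   trans (∣toSubset∣ (suc m) (notTwoMod3Below m)) (∑-notTwoMod3Below m)) ,
  cycle-packing≤ (suc k) (s≤s z≤n)
  where
  m = suc (suc k)

part-↑ʳ : ∀ m {k} (ms : Vec ℕ k) w → part (m ∷ ms) (m ↑ʳ w) ≡ F.suc (part ms w)
part-↑ʳ m ms w rewrite splitAt-↑ʳ m (sum ms) w = refl

vertexInPart : ∀ {n} (ms : Vec ℕ n) → (∀ i → 1 ≤ lookup ms i) → (p : Fin n) → ∃[ w ] part ms w ≡ p
vertexInPart (m ∷ ms) nonempty F.zero with nonempty F.zero
... | s≤s _ = F.zero , refl
vertexInPart (m ∷ ms) nonempty (F.suc p) with vertexInPart ms (nonempty ∘ F.suc) p
... | w , refl = m ↑ʳ w , part-↑ʳ m ms w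

closedNbhd-multipartite : ∀ {n} (ms : Vec ℕ n) {c u} → u ≡ c ⊎ part ms u ≢ part ms c
                        → T (lookup (closedNbhd (completeMultipartite ms) c) u)
closedNbhd-multipartite ms {c} {u} u∼c
  rewrite lookup∘tabulate (λ u → (toℕ u ≡ᵇ toℕ c) ∨ completeMultipartite ms c u) u =
  from T-∨ (seen u∼c)
  where
  seen : u ≡ c ⊎ part ms u ≢ part ms c → T (toℕ u ≡ᵇ toℕ c) ⊎ T (completeMultipartite ms c u)
  seen (inj₁ refl) = inj₁ (≡⇒≡ᵇ (toℕ u) (toℕ u) refl)
  seen (inj₂ u≁c)  = inj₂ (≢⇒T-not-≡ᵇ (λ c~u → u≁c (sym (toℕ-injective c~u))))

otherPart : ∀ {k} → Fin (suc (suc k)) → Fin (suc (suc k))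
otherPart F.zero    = F.suc F.zero
otherPart (F.suc _) = F.zero

otherPart-≢ : ∀ {k} (p : Fin (suc (suc k))) → otherPart p ≢ p
otherPart-≢ F.zero    ()
otherPart-≢ (F.suc p) ()

2≤sum : ∀ {k} (ms : Vec ℕ (suc (suc k))) → (∀ i → 1 ≤ lookup ms i) → 2 ≤ sum ms
2≤sum (a ∷ b ∷ rest) nonempty =
  +-mono-≤ (nonempty F.zero) (≤-trans (nonempty (F.suc F.zero)) (m≤m+n b (sum rest)))

module _ {k} (ms : Vec ℕ (suc (suc k))) (nonempty : ∀ i → 1 ≤ lookup ms i) where

  private
    G = completeMultipartite ms
    P = part ms
    seen : ∀ {c u} → u ≡ c ⊎ P u ≢ P c → T (lookup (closedNbhd G c) u)
    seen = closedNbhd-multipartite ms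

  multipartite-common : ∀ u v w → CommonClosedNbhd G u v w
  multipartite-common u v w with P u F.≟ P v | P u F.≟ P w
  ... | no u≁v  | no u≁w  = u , seen (inj₁ refl) , seen (inj₂ (u≁v ∘ sym)) , seen (inj₂ (u≁w ∘ sym))
  ... | no u≁v  | yes u~w = v , seen (inj₂ u≁v) , seen (inj₁ refl) , seen (inj₂ (u≁v ∘ trans u~w))
  ... | yes u~v | no u≁w  = w , seen (inj₂ u≁w) , seen (inj₂ (u≁w ∘ trans u~v)) , seen (inj₁ refl)
  ... | yes u~v | yes u~w with vertexInPart ms nonempty (otherPart (P u))
  ...   | c , c∈other =
    c , seen (inj₂ u≁c) , seen (inj₂ (u≁c ∘ trans u~v)) , seen (inj₂ (u≁c ∘ trans u~w))
    where
    u≁c : P u ≢ P c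
    u≁c u~c = otherPart-≢ (P u) (trans (sym c∈other) (sym u~c))

  multipartite-twoPackingNumber : TwoPackingNumberIs G 2
  multipartite-twoPackingNumber with subsetOfSize (2≤sum ms nonempty)
  ... | W , ∣W∣≡2 =
    (W , ∣∣≤2⇒packing G (≤-reflexive ∣W∣≡2) , ∣W∣≡2) , common⇒packing≤2 G multipartite-common

mainTheorem7 : ((n : ℕ) → 1 ≤ n → TwoPackingNumberIs (pathGraph n) ((2 * n + 2) / 3))
    × ((n : ℕ) → 3 ≤ n → TwoPackingNumberIs (cycleGraph n) ((2 * n) / 3))
    × ((n : ℕ) → 2 ≤ n → (ms : Vec ℕ n)
    → (∀ (i : Fin n) → 1 ≤ lookup ms i)
    → (∀ (i j : Fin n) → i ≤ᶠ j → lookup ms i ≤ lookup ms j)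
    → TwoPackingNumberIs (completeMultipartite ms) 2)
mainTheorem7 = path-twoPackingNumber , cycle-twoPackingNumber , multipartite
  where
  multipartite : (n : ℕ) → 2 ≤ n → (ms : Vec ℕ n) → (∀ i → 1 ≤ lookup ms i)
               → (∀ i j → i ≤ᶠ j → lookup ms i ≤ lookup ms j)
               → TwoPackingNumberIs (completeMultipartite ms) 2
  multipartite 1             (s≤s ())
  multipartite (suc (suc k)) _ ms nonempty _ = multipartite-twoPackingNumber ms nonempty
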